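{- Let $G=(V,E)$ be a finite simple graph on $n$ vertices. Suppose that either (1) $a(G)\geq \frac n2$ and $\alpha'(G)=a(G)$, or (2) $a(G)=\frac{n-1}{2}$ and $\alpha'(G-v)=a(G)$ for some vertex $v\in V$. Then $\alpha(G)=a(G)$.
   Context: All graphs are finite and simple. $\alpha(G)$ denotes the independence number of $G$. For a set $S\subseteq V$, $\mathcal{N}(S)$ denotes the set of vertices adjacent to at least one vertex of $S$. An independent set $I$ is critical if $|I|-|\mathcal{N}(I)|$ is maximum among all independent sets of $G$; the critical independence number $\alpha'(G)$ is the maximum cardinality of a critical independent set. The annihilation number $a(G)$ is defined as follows: if $d_1\leq d_2\leq\dots\leq d_n$ are the vertex degrees of $G$ in nondecreasing order, $a(G)$ is the largest $k$ such that $\sum_{i=1}^k d_i\leq |E|$ (i.e. at most half the total degree sum). $G-v$ denotes the graph obtained by deleting $v$ and its incident edges. -}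

module Defs where

open import Data.Nat using (ℕ; zero; suc; pred; _+_; _*_; _≤_)
open import Data.Nat.Properties using (≤-decTotalOrder)
open import Data.Integer using (ℤ; _-_; +_) renaming (_≤_ to _≤ℤ_)
open import Data.Bool using (Bool; true; false; _∧_; _∨_; if_then_else_)
open import Data.Fin using (Fin; zero; suc; punchIn)
open import Data.Fin.Subset using (Subset; _∈_; ∣_∣)
open import Data.Vec using (tabulate)
open import Data.List using (List; take; map; allFin)
open import Data.Nat.ListAction using (sum)
open import Data.Product using (Σ; _×_; _,_)
open import Relation.Binary.PropositionalEquality using (_≡_)
import Data.List.Sort

record Graph (n : ℕ) : Set where
  field
    adj    : Fin n → Fin n → Bool
    sym    : ∀ u v → adj u v ≡ adj v u
    irrefl : ∀ v → adj v v ≡ false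
open Graph public

countT : {n : ℕ} → (Fin n → Bool) → ℕ
countT {zero}  f = 0
countT {suc n} f = (if f zero then 1 else 0) + countT (λ i → f (suc i))

anyT : {n : ℕ} → (Fin n → Bool) → Bool
anyT {zero}  f = false
anyT {suc n} f = f zero ∨ anyT (λ i → f (suc i))

degree : {n : ℕ} → Graph n → Fin n → ℕ
degree G v = countT (adj G v)

degreeSum : {n : ℕ} → Graph n → ℕ
degreeSum {n} G = sum (map (degree G) (allFin n))

open Data.List.Sort ≤-decTotalOrder using (sort)

sortedDegrees : {n : ℕ} → Graph n → List ℕ
sortedDegrees {n} G = sort (map (degree G) (allFin n))

-- d_1 + ... + d_k ≤ |E|, written as 2 (d_1 + ... + d_k) ≤ Σ deg
AnnihCond : {n : ℕ} → Graph n → ℕ → Set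
AnnihCond G k = 2 * sum (take k (sortedDegrees G)) ≤ degreeSum G

IsAnnihilationNumber : {n : ℕ} → Graph n → ℕ → Set
IsAnnihilationNumber {n} G k =
  k ≤ n × AnnihCond G k × (∀ j → j ≤ n → AnnihCond G j → j ≤ k)

Independent : {n : ℕ} → Graph n → Subset n → Set
Independent G I = ∀ u v → u ∈ I → v ∈ I → adj G u v ≡ false

nbhd : {n : ℕ} → Graph n → Subset n → Subset n
nbhd G S = tabulate (λ w → anyT (λ u → Data.Vec.lookup S u ∧ adj G u w))

diff : {n : ℕ} → Graph n → Subset n → ℤ
diff G I = + ∣ I ∣ - + ∣ nbhd G I ∣

Critical : {n : ℕ} → Graph n → Subset n → Set
Critical G I = Independent G I × (∀ J → Independent G J → diff G J ≤ℤ diff G I)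

IsIndependenceNumber : {n : ℕ} → Graph n → ℕ → Set
IsIndependenceNumber G k =
  Σ (Subset _) (λ I → Independent G I × ∣ I ∣ ≡ k) × (∀ I → Independent G I → ∣ I ∣ ≤ k)

IsCriticalIndependenceNumber : {n : ℕ} → Graph n → ℕ → Set
IsCriticalIndependenceNumber G k =
  Σ (Subset _) (λ I → Critical G I × ∣ I ∣ ≡ k) × (∀ I → Critical G I → ∣ I ∣ ≤ k)

deleteVertex : {n : ℕ} → Graph n → Fin n → Graph (pred n)
deleteVertex {suc m} G v = record
  { adj    = λ u w → adj G (punchIn v u) (punchIn v w)
  ; sym    = λ u w → sym G (punchIn v u) (punchIn v w)
  ; irrefl = λ u → irrefl G (punchIn v u)
  }

-- Each edge has at most one endpoint in an independent set I, so 2 Σ_{u ∈ I} deg u ≤ Σ deg.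
-- The |I| smallest degrees sum to at most Σ_{u ∈ I} deg u, hence |I| satisfies the
-- annihilation condition and α(G) ≤ a(G) for every graph. Conversely, either hypothesis
-- supplies an independent set of size a(G): a critical independent set of G, or one of G - v,
-- which remains independent in G.
module Submission where

open import Defs
open import Data.Nat using (ℕ; zero; suc; _+_; _*_; _≤_; _<_; z≤n; s≤s)
open import Data.Nat.Properties
open import Data.Fin as Fin using (Fin; zero; suc; punchIn; punchOut)
open import Data.Fin.Properties using (punchIn-punchOut)
open import Data.Fin.Subset using (Subset; _∈_; ∣_∣; inside; outside)
open import Data.Fin.Subset.Properties using (∣p∣≤n)
open import Data.Bool using (Bool; true; false; if_then_else_)
open import Data.List using (List; []; _∷_; take; length; map; allFin; tabulate)
open import Data.List.Properties using (map-tabulate)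
open import Data.List.Relation.Binary.Permutation.Propositional
  using (_↭_; refl; prep; swap; trans; ↭-sym)
open import Data.List.Relation.Binary.Permutation.Propositional.Properties using (↭-length)
open import Data.List.Relation.Unary.All using (All; _∷_)
open import Data.List.Relation.Unary.AllPairs using (AllPairs; _∷_)
open import Data.List.Relation.Unary.Linked.Properties using (Linked⇒AllPairs)
open import Data.List.Sort ≤-decTotalOrder using (sort; sort-↭; sort-↗)
open import Data.Nat.ListAction using (sum)
open import Data.Nat.ListAction.Properties using (sum-↭)
open import Data.Vec using ([]; _∷_; lookup; toList; insertAt)
open import Data.Vec.Properties using ([]=⇒lookup; lookup⇒[]=; insertAt-lookup; insertAt-punchIn)
open import Data.Product using (Σ; ∃-syntax; _×_; _,_)
open import Data.Sum using (_⊎_; inj₁; inj₂)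
open import Relation.Nullary using (yes; no; contradiction)
open import Relation.Binary.PropositionalEquality
  using (_≡_; refl; cong; cong₂; subst; subst₂; module ≡-Reasoning) renaming (sym to ≡-sym; trans to ≡-trans)
open import Algebra.Properties.CommutativeSemigroup +-commutativeSemigroup using (x∙yz≈y∙xz)
open import Algebra.Properties.Semiring.Sum +-*-semiring
  using (sum-syntax; sum-cong-≗; ∑-distrib-+; ∑-comm; *-distribˡ-sum)
  renaming (sum to ∑)

select : {A : Set} → List Bool → List A → List A
select []           _        = []
select (_ ∷ _)      []       = []
select (true  ∷ bs) (x ∷ xs) = x ∷ select bs xs
select (false ∷ bs) (x ∷ xs) = select bs xs

length-select≤ : {A : Set} (bs : List Bool) (xs : List A) → length (select bs xs) ≤ length xs
length-select≤ []           _        = z≤n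
length-select≤ (_ ∷ _)      []       = z≤n
length-select≤ (true  ∷ bs) (x ∷ xs) = s≤s (length-select≤ bs xs)
length-select≤ (false ∷ bs) (x ∷ xs) = m≤n⇒m≤1+n (length-select≤ bs xs)

select-↭ : {A : Set} {xs ys : List A} → xs ↭ ys →
  ∀ bs → ∃[ bs′ ] select bs′ ys ↭ select bs xs
select-↭ refl bs = bs , refl
select-↭ (prep x p) [] = [] , refl
select-↭ (prep x p) (true ∷ bs) with select-↭ p bs
... | bs′ , q = true ∷ bs′ , prep x q
select-↭ (prep x p) (false ∷ bs) with select-↭ p bs
... | bs′ , q = false ∷ bs′ , q
select-↭ (swap x y p) [] = [] , refl
select-↭ (swap x y p) (true ∷ []) = false ∷ true ∷ [] , refl
select-↭ (swap x y p) (false ∷ []) = [] , refl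
select-↭ (swap x y p) (b₁ ∷ b₂ ∷ bs) with select-↭ p bs
select-↭ (swap x y p) (true  ∷ true  ∷ bs) | bs′ , q = true  ∷ true  ∷ bs′ , swap y x q
select-↭ (swap x y p) (true  ∷ false ∷ bs) | bs′ , q = false ∷ true  ∷ bs′ , prep x q
select-↭ (swap x y p) (false ∷ true  ∷ bs) | bs′ , q = true  ∷ false ∷ bs′ , prep y q
select-↭ (swap x y p) (false ∷ false ∷ bs) | bs′ , q = false ∷ false ∷ bs′ , q
select-↭ (trans p q) bs with select-↭ p bs
... | bs₁ , r with select-↭ q bs₁
...   | bs₂ , s = bs₂ , trans s r

sum-take-cons≤ : ∀ {y} ys k → All (y ≤_) ys → k < length ys →
  y + sum (take k ys) ≤ sum (take (suc k) ys)
sum-take-cons≤     (z ∷ zs) zero    (y≤z ∷ _)  _            = +-monoˡ-≤ 0 y≤z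
sum-take-cons≤ {y} (z ∷ zs) (suc k) (_ ∷ y≤zs) (s≤s k<∣zs∣) = begin
  y + (z + sum (take k zs))  ≡⟨ x∙yz≈y∙xz y z _ ⟩
  z + (y + sum (take k zs))  ≤⟨ +-monoʳ-≤ z (sum-take-cons≤ zs k y≤zs k<∣zs∣) ⟩
  z + sum (take (suc k) zs)  ∎
  where open ≤-Reasoning

sum-take-sorted≤sum-select : ∀ ys → AllPairs _≤_ ys → ∀ bs →
  sum (take (length (select bs ys)) ys) ≤ sum (select bs ys)
sum-take-sorted≤sum-select []       _           []       = z≤n
sum-take-sorted≤sum-select []       _           (_ ∷ _)  = z≤n
sum-take-sorted≤sum-select (y ∷ ys) _           []       = z≤n
sum-take-sorted≤sum-select (y ∷ ys) (_ ∷ sorted) (true ∷ bs) =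
  +-monoʳ-≤ y (sum-take-sorted≤sum-select ys sorted bs)
sum-take-sorted≤sum-select (y ∷ ys) (y≤ys ∷ sorted) (false ∷ bs)
  with length (select bs ys) | length-select≤ bs ys | sum-take-sorted≤sum-select ys sorted bs
... | zero  | _       | _  = z≤n
... | suc k | k<∣ys∣ | ih = ≤-trans (sum-take-cons≤ ys k y≤ys k<∣ys∣) ih

sum-take-sort≤sum-select : ∀ xs bs → sum (take (length (select bs xs)) (sort xs)) ≤ sum (select bs xs)
sum-take-sort≤sum-select xs bs with select-↭ (↭-sym (sort-↭ xs)) bs
... | bs′ , p =
  subst₂ (λ k s → sum (take k (sort xs)) ≤ s) (↭-length p) (sum-↭ p)
    (sum-take-sorted≤sum-select (sort xs) (Linked⇒AllPairs ≤-trans (sort-↗ xs)) bs′)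

[_] : Bool → ℕ
[ b ] = if b then 1 else 0

countT≡∑ : ∀ {n} (f : Fin n → Bool) → countT f ≡ ∑[ i < n ] [ f i ]
countT≡∑ {zero}  f = refl
countT≡∑ {suc n} f = cong ([ f zero ] +_) (countT≡∑ (λ i → f (suc i)))

∑-mono-≤ : ∀ {n} {f g : Fin n → ℕ} → (∀ i → f i ≤ g i) → ∑[ i < n ] f i ≤ ∑[ i < n ] g i
∑-mono-≤ {zero}  f≤g = z≤n
∑-mono-≤ {suc n} f≤g = +-mono-≤ (f≤g zero) (∑-mono-≤ (λ i → f≤g (suc i)))

sum-tabulate : ∀ {n} (f : Fin n → ℕ) → sum (tabulate f) ≡ ∑[ i < n ] f i
sum-tabulate {zero}  f = refl
sum-tabulate {suc n} f = cong (f zero +_) (sum-tabulate (λ i → f (suc i)))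

sum-select-tabulate : ∀ {n} (I : Subset n) (f : Fin n → ℕ) →
  sum (select (toList I) (tabulate f)) ≡ ∑[ i < n ] ([ lookup I i ] * f i)
sum-select-tabulate []            f = refl
sum-select-tabulate (inside ∷ I)  f =
  cong₂ _+_ (≡-sym (*-identityˡ (f zero))) (sum-select-tabulate I (λ i → f (suc i)))
sum-select-tabulate (outside ∷ I) f = sum-select-tabulate I (λ i → f (suc i))

length-select-tabulate : ∀ {n} (I : Subset n) (f : Fin n → ℕ) →
  length (select (toList I) (tabulate f)) ≡ ∣ I ∣
length-select-tabulate []            f = refl
length-select-tabulate (inside ∷ I)  f = cong suc (length-select-tabulate I (λ i → f (suc i)))
length-select-tabulate (outside ∷ I) f = length-select-tabulate I (λ i → f (suc i))

[x][a]+[y][a]≤[a] : ∀ x y a → (x ≡ true → y ≡ true → a ≡ false) → [ x ] * [ a ] + [ y ] * [ a ] ≤ [ a ]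
[x][a]+[y][a]≤[a] true  true  true  excl = contradiction (excl refl refl) (λ ())
[x][a]+[y][a]≤[a] true  true  false _    = z≤n
[x][a]+[y][a]≤[a] true  false true  _    = ≤-refl
[x][a]+[y][a]≤[a] true  false false _    = z≤n
[x][a]+[y][a]≤[a] false true  true  _    = ≤-refl
[x][a]+[y][a]≤[a] false true  false _    = z≤n
[x][a]+[y][a]≤[a] false false true  _    = z≤n
[x][a]+[y][a]≤[a] false false false _    = z≤n

module _ {n : ℕ} (G : Graph n) where

  degreeSum≡∑∑adj : degreeSum G ≡ ∑[ u < n ] ∑[ w < n ] [ adj G u w ]
  degreeSum≡∑∑adj = begin
    sum (map (degree G) (allFin n))   ≡⟨ cong sum (map-tabulate (λ i → i) (degree G)) ⟩
    sum (tabulate (degree G))         ≡⟨ sum-tabulate (degree G) ⟩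
    ∑[ u < n ] degree G u             ≡⟨ sum-cong-≗ (λ u → countT≡∑ (adj G u)) ⟩
    ∑[ u < n ] ∑[ w < n ] [ adj G u w ] ∎
    where open ≡-Reasoning

  2*∑degree≤degreeSum : ∀ I → Independent G I →
    2 * ∑[ u < n ] ([ lookup I u ] * degree G u) ≤ degreeSum G
  2*∑degree≤degreeSum I independent = begin
    2 * X                                                 ≡⟨ cong (X +_) (+-identityʳ X) ⟩
    X + X                                                 ≡⟨ cong₂ _+_ rows columns ⟨
    ∑[ u < n ] ∑[ w < n ] P u w + ∑[ u < n ] ∑[ w < n ] Q u w
                                                          ≡⟨ ∑-distrib-+ (λ u → ∑[ w < n ] P u w) _ ⟨
    ∑[ u < n ] (∑[ w < n ] P u w + ∑[ w < n ] Q u w)      ≡⟨ sum-cong-≗ (λ u → ∑-distrib-+ (P u) (Q u)) ⟨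
    ∑[ u < n ] ∑[ w < n ] (P u w + Q u w)                 ≤⟨ ∑-mono-≤ (λ u → ∑-mono-≤ (λ w → P+Q≤A u w)) ⟩
    ∑[ u < n ] ∑[ w < n ] [ adj G u w ]                   ≡⟨ degreeSum≡∑∑adj ⟨
    degreeSum G                                           ∎
    where
    open ≤-Reasoning
    X : ℕ
    X = ∑[ u < n ] ([ lookup I u ] * degree G u)

    P Q : Fin n → Fin n → ℕ
    P u w = [ lookup I u ] * [ adj G u w ]
    Q u w = [ lookup I w ] * [ adj G u w ]

    P+Q≤A : ∀ u w → P u w + Q u w ≤ [ adj G u w ]
    P+Q≤A u w = [x][a]+[y][a]≤[a] (lookup I u) (lookup I w) (adj G u w)
      (λ u∈I w∈I → independent u w (lookup⇒[]= u I u∈I) (lookup⇒[]= w I w∈I))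

    rows : ∑[ u < n ] ∑[ w < n ] P u w ≡ X
    rows = sum-cong-≗ λ u →
      ≡-trans (≡-sym (*-distribˡ-sum [ lookup I u ] (λ w → [ adj G u w ])))
              (cong ([ lookup I u ] *_) (≡-sym (countT≡∑ (adj G u))))

    columns : ∑[ u < n ] ∑[ w < n ] Q u w ≡ X
    columns = ≡-trans (∑-comm Q)
      (≡-trans (sum-cong-≗ λ w → sum-cong-≗ λ u → cong (λ b → [ lookup I w ] * [ b ]) (sym G u w)) rows)

  independent⇒AnnihCond : ∀ I → Independent G I → AnnihCond G ∣ I ∣
  independent⇒AnnihCond I independent =
    subst (λ ds → 2 * sum (take ∣ I ∣ (sort ds)) ≤ degreeSum G)
      (≡-sym (map-tabulate (λ i → i) (degree G))) bound
    where
    degrees : List ℕ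
    degrees = tabulate (degree G)
    bound : 2 * sum (take ∣ I ∣ (sort degrees)) ≤ degreeSum G
    bound = begin
      2 * sum (take ∣ I ∣ (sort degrees))
        ≡⟨ cong (λ k → 2 * sum (take k (sort degrees))) (length-select-tabulate I (degree G)) ⟨
      2 * sum (take (length (select (toList I) degrees)) (sort degrees))
        ≤⟨ *-monoʳ-≤ 2 (sum-take-sort≤sum-select degrees (toList I)) ⟩
      2 * sum (select (toList I) degrees)
        ≡⟨ cong (2 *_) (sum-select-tabulate I (degree G)) ⟩
      2 * ∑[ u < n ] ([ lookup I u ] * degree G u)
        ≤⟨ 2*∑degree≤degreeSum I independent ⟩
      degreeSum G ∎
      where open ≤-Reasoning

  independent⇒≤annihilationNumber : ∀ {a} → IsAnnihilationNumber G a →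
    ∀ I → Independent G I → ∣ I ∣ ≤ a
  independent⇒≤annihilationNumber (_ , _ , maximal) I independent =
    maximal ∣ I ∣ (∣p∣≤n I) (independent⇒AnnihCond I independent)

∣insertAt-outside∣ : ∀ {m} (J : Subset m) (v : Fin (suc m)) → ∣ insertAt J v outside ∣ ≡ ∣ J ∣
∣insertAt-outside∣ J            zero    = refl
∣insertAt-outside∣ (inside ∷ J)  (suc v) = cong suc (∣insertAt-outside∣ J v)
∣insertAt-outside∣ (outside ∷ J) (suc v) = ∣insertAt-outside∣ J v

∈-insertAt-outside : ∀ {m} (J : Subset m) (v : Fin (suc m)) {u} →
  u ∈ insertAt J v outside → ∃[ u′ ] punchIn v u′ ≡ u × u′ ∈ J
∈-insertAt-outside J v {u} u∈ with v Fin.≟ u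
... | yes refl = contradiction (≡-trans (≡-sym (insertAt-lookup J v outside)) ([]=⇒lookup u∈)) λ ()
... | no v≢u   = punchOut v≢u , punchIn-punchOut v≢u , lookup⇒[]= _ J (begin
  lookup J (punchOut v≢u)
    ≡⟨ insertAt-punchIn J v outside _ ⟨
  lookup (insertAt J v outside) (punchIn v (punchOut v≢u))
    ≡⟨ cong (lookup (insertAt J v outside)) (punchIn-punchOut v≢u) ⟩
  lookup (insertAt J v outside) u
    ≡⟨ []=⇒lookup u∈ ⟩
  inside ∎)
  where open ≡-Reasoning

independent-deleteVertex⇒independent : ∀ {m} (G : Graph (suc m)) (v : Fin (suc m)) (J : Subset m) →
  Independent (deleteVertex G v) J → Independent G (insertAt J v outside)
independent-deleteVertex⇒independent G v J independent u w u∈ w∈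
  with ∈-insertAt-outside J v u∈ | ∈-insertAt-outside J v w∈
... | u′ , refl , u′∈J | w′ , refl , w′∈J = independent u′ w′ u′∈J w′∈J

lemma2 : (n : ℕ) (G : Graph n) (a : ℕ) → IsAnnihilationNumber G a →
    ((n ≤ 2 * a × IsCriticalIndependenceNumber G a)
     ⊎ (2 * a + 1 ≡ n × Σ (Fin n) (λ v → IsCriticalIndependenceNumber (deleteVertex G v) a)))
    → IsIndependenceNumber G a
lemma2 n G a isAnnih (inj₁ (_ , (I , (independent , _) , ∣I∣≡a) , _)) =
  (I , independent , ∣I∣≡a) , independent⇒≤annihilationNumber G isAnnih
lemma2 (suc m) G a isAnnih (inj₂ (_ , v , (J , (independent , _) , ∣J∣≡a) , _)) =
  ( insertAt J v outside
  , independent-deleteVertex⇒independent G v J independent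
  , ≡-trans (∣insertAt-outside∣ J v) ∣J∣≡a )
  , independent⇒≤annihilationNumber G isAnnih
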